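{- Let $F$ be a 2-CNF formula, $L$ a set of literals such that $SWRT(F,\neg L)$ is true, and $l_y$ a literal with $Var(l_y)\notin Var(L)$. Let $D$ be the implication graph of $F$. Then: (1) the largest number $MaxPaths(F,L,l_y)$ of pairwise clause-disjoint paths of $F$ from $L$ to $l_y$ equals the largest number of pairwise arc-disjoint paths of $D$ from $\neg L$ to $l_y$; (2) $SepSize(F,L,l_y)=ArcSepSize(D,\neg L,l_y)$; (3) $MaxPaths(F,L,l_y)=SepSize(F,L,l_y)$.
   Context: A literal is a Boolean variable or its negation; $\neg$ denotes negation, and for a set $L$ of literals $\neg L=\{\neg l': l'\in L\}$. $Var(\cdot)$ denotes the set of variables. A 2-CNF formula $F$ is a conjunction of clauses each consisting of exactly two literals (a one-literal clause $(l)$ is written $(l\vee l)$; $(l_1\vee l_2)$ and $(l_2\vee l_1)$ are the same clause), with pairwise distinct clauses; $F\setminus S$ denotes the formula of clauses of $F$ not in the set $S$. A set of literals is non-contradictory if it contains no literal and its negation. A satisfying assignment of $F$ is a non-contradictory set $P$ of literals with $Var(P)=Var(F)$ such that each clause of $F$ contains a literal of $P$. $SWRT(F,M)$ means $F$ has a satisfying assignment $P$ with $P\cap \neg M=\emptyset$. A walk of $F$ is a nonempty sequence $(C_1,\dots,C_q)$ of (not necessarily distinct) clauses of $F$ where in each entry one literal is designated first and the other second, such that for $i<q$ the second literal of $C_i$ is the negation of the first literal of $C_{i+1}$; it is from the first literal of $C_1$ to the second literal of $C_q$, and from a set $M$ if its first literal lies in $M$. A path of $F$ is a walk whose clauses are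 pairwise distinct; paths are clause-disjoint if no clause occurs in two of them. A separator of $F$ w.r.t. a set of literals $M$ and literal $l_y$ is a set $SC$ of clauses of $F$ such that $F\setminus SC$ has no path from $M$ to $l_y$; $SepSize(F,M,l_y)$ is its minimum size. The implication graph $D$ of $F$ is the digraph whose vertices are the literals of the variables of $F$, with an arc $(l_1,l_2)$ iff $(\neg l_1\vee l_2)$ is a clause of $F$. Paths in $D$ are directed paths (no repeated vertices) with at least one arc, and a path from a vertex set $M$ starts at a vertex of $M$. An arc separator of $D$ w.r.t. $M$ and $l_y$ is a set of arcs whose removal leaves no path from $M$ to $l_y$; $ArcSepSize(D,M,l_y)$ is its minimum size. -}

module Defs where

open import Data.Nat using (ℕ; _≤_)
open import Data.Bool using (Bool; not)
open import Data.Product using (Σ; _×_; _,_; proj₁; proj₂; ∃)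
open import Data.Sum using (_⊎_)
open import Data.List using (List; []; _∷_; length; map)
open import Data.List.NonEmpty using (List⁺; _∷_; head; last; toList)
open import Data.List.Membership.Propositional using (_∈_; _∉_)
open import Data.List.Relation.Unary.All using (All)
open import Data.List.Relation.Unary.Any using (Any)
open import Data.List.Relation.Unary.AllPairs using (AllPairs)
open import Data.List.Relation.Unary.Linked using (Linked)
open import Relation.Binary.PropositionalEquality using (_≡_)
open import Relation.Nullary using (¬_)

-- A literal: a Boolean variable (a natural number) with a polarity
-- (true = positive, false = negated).
record Lit : Set where
  constructor mkLit
  field
    var : ℕ
    pos : Bool
open Lit public

neg : Lit → Lit
neg (mkLit v b) = mkLit v (not b)

negs : List Lit → List Lit
negs = map neg

-- A clause (l₁ ∨ l₂); a one-literal clause (l) is (l , l).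
Clause : Set
Clause = Lit × Lit

swapC : Clause → Clause
swapC (a , b) = (b , a)

-- (l₁ ∨ l₂) and (l₂ ∨ l₁) are the same clause.
SameClause : Clause → Clause → Set
SameClause c d = (c ≡ d) ⊎ (swapC c ≡ d)

record TwoCNF : Set where
  constructor mkCNF
  field
    clauses  : List Clause
    distinct : AllPairs (λ c d → ¬ SameClause c d) clauses
open TwoCNF public

_∈C_ : Clause → List Clause → Set
c ∈C cs = Any (SameClause c) cs

VarOfF : TwoCNF → ℕ → Set
VarOfF F x = Any (λ c → (var (proj₁ c) ≡ x) ⊎ (var (proj₂ c) ≡ x)) (clauses F)

VarOfLits : List Lit → ℕ → Set
VarOfLits L x = Any (λ l → var l ≡ x) L

NonContradictory : List Lit → Set
NonContradictory P = ∀ l → l ∈ P → neg l ∉ P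

IsSatAssignment : TwoCNF → List Lit → Set
IsSatAssignment F P =
  NonContradictory P ×
  (∀ x → VarOfLits P x → VarOfF F x) ×
  (∀ x → VarOfF F x → VarOfLits P x) ×
  All (λ c → (proj₁ c ∈ P) ⊎ (proj₂ c ∈ P)) (clauses F)

SWRT : TwoCNF → List Lit → Set
SWRT F M = Σ (List Lit) λ P → IsSatAssignment F P × (∀ l → l ∈ P → l ∉ negs M)

-- An oriented clause entry: (first literal , second literal).
IsWalk : TwoCNF → List⁺ Clause → Set
IsWalk F w =
  All (λ s → s ∈C clauses F) (toList w) ×
  Linked (λ s t → proj₂ s ≡ neg (proj₁ t)) (toList w)

IsPath : TwoCNF → List⁺ Clause → Set
IsPath F w = IsWalk F w × AllPairs (λ s t → ¬ SameClause s t) (toList w)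

IsPathFromTo : TwoCNF → List Lit → Lit → List⁺ Clause → Set
IsPathFromTo F M l w = IsPath F w × (proj₁ (head w) ∈ M) × (proj₂ (last w) ≡ l)

ClauseDisjoint : List⁺ Clause → List⁺ Clause → Set
ClauseDisjoint p q = All (λ s → All (λ t → ¬ SameClause s t) (toList q)) (toList p)

DisjPathFamily : TwoCNF → List Lit → Lit → List (List⁺ Clause) → Set
DisjPathFamily F M l ps = All (IsPathFromTo F M l) ps × AllPairs ClauseDisjoint ps

IsMaxPaths : TwoCNF → List Lit → Lit → ℕ → Set
IsMaxPaths F M l k =
  (Σ (List (List⁺ Clause)) λ ps → DisjPathFamily F M l ps × length ps ≡ k) ×
  (∀ ps → DisjPathFamily F M l ps → length ps ≤ k)

-- separator: a set SC of clauses of F s.t. F∖SC has no path from M to l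
-- (paths of F∖SC are exactly the paths of F using no clause of SC)
IsSeparator : TwoCNF → List Lit → Lit → List Clause → Set
IsSeparator F M l SC =
  All (λ c → c ∈C clauses F) SC ×
  AllPairs (λ c d → ¬ SameClause c d) SC ×
  (∀ w → IsPathFromTo F M l w → ¬ All (λ s → ¬ (s ∈C SC)) (toList w))

IsSepSize : TwoCNF → List Lit → Lit → ℕ → Set
IsSepSize F M l k =
  (Σ (List Clause) λ SC → IsSeparator F M l SC × length SC ≡ k) ×
  (∀ SC → IsSeparator F M l SC → k ≤ length SC)

Arc : Set
Arc = Lit × Lit

IsArc : TwoCNF → Arc → Set
IsArc F (l₁ , l₂) = (neg l₁ , l₂) ∈C clauses F

arcsOf : List Lit → List Arc
arcsOf []           = []
arcsOf (x ∷ [])     = []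
arcsOf (x ∷ y ∷ xs) = (x , y) ∷ arcsOf (y ∷ xs)

IsDPath : TwoCNF → List⁺ Lit → Set
IsDPath F p =
  (1 ≤ length (Data.List.NonEmpty.tail p)) ×
  AllPairs (λ u v → ¬ u ≡ v) (toList p) ×
  Linked (λ u v → IsArc F (u , v)) (toList p)

IsDPathFromTo : TwoCNF → List Lit → Lit → List⁺ Lit → Set
IsDPathFromTo F M l p = IsDPath F p × (head p ∈ M) × (last p ≡ l)

ArcDisjoint : List⁺ Lit → List⁺ Lit → Set
ArcDisjoint p q = All (λ a → a ∉ arcsOf (toList q)) (arcsOf (toList p))

DisjDPathFamily : TwoCNF → List Lit → Lit → List (List⁺ Lit) → Set
DisjDPathFamily F M l ps = All (IsDPathFromTo F M l) ps × AllPairs ArcDisjoint ps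

IsMaxArcPaths : TwoCNF → List Lit → Lit → ℕ → Set
IsMaxArcPaths F M l k =
  (Σ (List (List⁺ Lit)) λ ps → DisjDPathFamily F M l ps × length ps ≡ k) ×
  (∀ ps → DisjDPathFamily F M l ps → length ps ≤ k)

IsArcSeparator : TwoCNF → List Lit → Lit → List Arc → Set
IsArcSeparator F M l AS =
  All (IsArc F) AS ×
  AllPairs (λ a b → ¬ a ≡ b) AS ×
  (∀ p → IsDPathFromTo F M l p → ¬ All (λ a → a ∉ AS) (arcsOf (toList p)))

IsArcSepSize : TwoCNF → List Lit → Lit → ℕ → Set
IsArcSepSize F M l k =
  (Σ (List Arc) λ AS → IsArcSeparator F M l AS × length AS ≡ k) ×
  (∀ AS → IsArcSeparator F M l AS → k ≤ length AS)

module Submission where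

-- Menger's theorem for arc-disjoint paths is proved for an arbitrary
-- finite digraph (Walks.Menger) by augmenting paths: the used arcs form a
-- flow, bookkept as a permutation between the multisets of their heads and
-- tails; an augmenting path in the residual graph raises its value, and the
-- flow splits into arc-disjoint routes again; without an augmenting path the
-- arcs leaving the residually reachable set form a cut with at most one arc
-- per route.  For D this yields k routes from ¬L to ly and an arc cut of size
-- at most k.  A satisfying assignment avoiding L makes every literal on the
-- routes true, so different route arcs come from different clauses (the arcs
-- u → v and ¬v → ¬u of one clause never both join true literals): the routes
-- are k clause-disjoint paths of F, and the clauses of the cut separate L
-- from ly in F.  Weak duality (a pigeonhole argument: disjoint paths are
-- bounded by any separator) makes all four quantities equal to k.

open import Defs

open import Level using (Level; 0ℓ)
open import Function using (_∘_; id)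
open import Data.Nat using (ℕ; zero; suc; _+_; _≤_; _<_; z≤n; s≤s) renaming (_≟_ to _ℕ≟_)
open import Data.Nat.Properties
  using (0≢1+n; ≤-refl; ≤-trans; ≤-reflexive; ≤-antisym; +-mono-≤; +-suc; +-identityʳ; m≤n+m; <⇒≱; suc-injective)
open import Data.Bool using () renaming (_≟_ to _Bool≟_)
open import Data.Bool.Properties using (not-involutive; ¬-not)
open import Data.Product using (Σ; ∃-syntax; _×_; _,_; proj₁; proj₂)
import Data.Product as Product
open import Data.Product.Properties using (≡-dec)
open import Data.Sum using (_⊎_; inj₁; inj₂; [_,_]′)
open import Data.Empty using (⊥-elim)
open import Data.List using (List; []; _∷_; [_]; length; _++_; concatMap; replicate; map; filter; deduplicate)
import Data.List as List
open import Data.List.Properties using (length-++; ++-assoc; ++-identityʳ; length-deduplicate; length-map)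
open import Data.List.NonEmpty using (List⁺; _∷_; head; last; toList)
open import Data.List.Relation.Unary.All as All using (All; []; _∷_)
open import Data.List.Relation.Unary.All.Properties using (¬Any⇒All¬; anti-mono)
import Data.List.Relation.Unary.All.Properties as AllP
open import Data.List.Relation.Unary.Any as Any using (Any; here; there; any?)
open import Data.List.Relation.Unary.AllPairs as APairs using (AllPairs; []; _∷_)
import Data.List.Relation.Unary.AllPairs.Properties as APairsP
open import Data.List.Relation.Unary.Linked using (Linked; []; [-]; _∷_)
open import Data.List.Relation.Unary.Unique.Propositional using (Unique)
open import Data.List.Relation.Unary.Unique.DecSetoid.Properties using ()
  renaming (deduplicate-! to deduplicate≈-!)
open import Data.List.Membership.Propositional using (_∈_; _∉_; find; lose)
open import Data.List.Membership.Propositional.Properties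
  using (∈-∃++; ∈-concat⁺′; ∈-++⁺ˡ; ∈-++⁺ʳ; ∈-++⁻; ∈-map⁺; ∈-map⁻; ∈-deduplicate⁺; ∈-deduplicate⁻)
open import Data.List.Membership.Setoid.Properties using (∈-filter⁺; ∈-filter⁻)
  renaming (∈-deduplicate⁺ to ∈-deduplicate≈⁺)
open import Data.List.Relation.Binary.Subset.Propositional using (_⊆_)
open import Data.List.Relation.Binary.Permutation.Propositional as Perm
  using (_↭_; ↭-refl; ↭-sym; ↭-trans; ↭-reflexive; prep; swap; module PermutationReasoning)
open import Data.List.Relation.Binary.Permutation.Propositional.Properties
  using (shift; shifts; drop-∷; ++⁺ˡ; ++⁺ʳ; ++⁺; ∈-resp-↭; ↭-length)
import Data.List.Relation.Binary.Permutation.Propositional.Properties as PermP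
import Data.List.Relation.Binary.Permutation.Setoid.Properties as PermSetoid
open import Relation.Binary.Bundles using (Setoid; DecSetoid)
open import Relation.Binary.Definitions using (DecidableEquality)
open import Relation.Binary.PropositionalEquality
  using (_≡_; refl; sym; trans; cong; subst; setoid; module ≡-Reasoning)
open import Relation.Nullary using (¬_; Dec; yes; no; ¬?)
open import Relation.Nullary.Decidable using (_×-dec_; _⊎-dec_)
open import Relation.Unary using (Decidable)

module _ {a : Level} {A : Set a} where

  length-insert : ∀ (v : A) P Q → length (P ++ v ∷ Q) ≡ suc (length (P ++ Q))
  length-insert v P Q = ↭-length (shift v P Q)

  ∈-delete : ∀ {x v : A} P Q → x ∈ P ++ v ∷ Q → ¬ x ≡ v → x ∈ P ++ Q
  ∈-delete []      Q (here x≡v) x≢v = ⊥-elim (x≢v x≡v)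
  ∈-delete []      Q (there x∈) _   = x∈
  ∈-delete (p ∷ P) Q (here x≡p) _   = here x≡p
  ∈-delete (p ∷ P) Q (there x∈) x≢v = there (∈-delete P Q x∈ x≢v)

  ∈-insert : ∀ {x v : A} P Q → x ∈ P ++ Q → x ∈ P ++ v ∷ Q
  ∈-insert []      Q x∈         = there x∈
  ∈-insert (p ∷ P) Q (here x≡p) = here x≡p
  ∈-insert (p ∷ P) Q (there x∈) = there (∈-insert P Q x∈)

  ↭-cancelˡ : ∀ (zs : List A) {xs ys} → zs ++ xs ↭ zs ++ ys → xs ↭ ys
  ↭-cancelˡ []       p = p
  ↭-cancelˡ (z ∷ zs) p = ↭-cancelˡ zs (drop-∷ p)

  exchange : (a b c : List A) → a ++ b ++ c ↭ c ++ b ++ a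
  exchange a b c =
    ↭-trans (PermP.++-comm a (b ++ c)) (↭-trans (↭-reflexive (++-assoc b c a)) (shifts b c))

  unique-↭ : ∀ {xs ys : List A} → xs ↭ ys → Unique xs → Unique ys
  unique-↭ p = PermSetoid.Unique-resp-↭ (setoid A) (Perm.↭⇒↭ₛ p)

  unique-delete : ∀ {v : A} P Q → Unique (P ++ v ∷ Q) → Unique (P ++ Q)
  unique-delete {v} P Q u with _ ∷ u′ ← unique-↭ (shift v P Q) u = u′

  unique-++⁻ : ∀ (xs : List A) {ys} → Unique (xs ++ ys) →
    Unique xs × Unique ys × (∀ {a} → a ∈ xs → a ∉ ys)
  unique-++⁻ []       u        = [] , u , λ ()
  unique-++⁻ (x ∷ xs) (x∉ ∷ u) with uxs , uys , disj ← unique-++⁻ xs u =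
    AllP.++⁻ˡ xs x∉ ∷ uxs , uys ,
    λ { (here refl) a∈ys → All.lookup (AllP.++⁻ʳ xs x∉) a∈ys refl ; (there a∈) → disj a∈ }

  unique-++⁺ : ∀ {xs ys : List A} → Unique xs → Unique ys → (∀ {a} → a ∈ xs → a ∉ ys) →
    Unique (xs ++ ys)
  unique-++⁺ {[]}     _          uys _    = uys
  unique-++⁺ {x ∷ xs} (x∉ ∷ uxs) uys disj =
    AllP.++⁺ x∉ (All.tabulate (λ y∈ x≡y → disj (here refl) (subst (_∈ _) (sym x≡y) y∈)))
    ∷ unique-++⁺ uxs uys (disj ∘ there)

  -- the last element of x ∷ xs, computed by structural recursion
  final : A → List A → A
  final x []       = x
  final x (y ∷ ys) = final y ys

  last≡final : ∀ x xs → last (x ∷ xs) ≡ final x xs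
  last≡final x [] = refl
  last≡final x (y ∷ ys) with List.initLast ys | last≡final y ys
  ... | List.[]       | eq = eq
  ... | zs List.∷ʳ′ z | eq = eq

  final-++ : ∀ x P y Q → final x (P ++ y ∷ Q) ≡ final y Q
  final-++ x []      y Q = refl
  final-++ x (z ∷ P) y Q = final-++ z P y Q

  final-split : ∀ {x y : A} {zs} P Q → y ∷ zs ≡ P ++ x ∷ Q → final y zs ≡ final x Q
  final-split []      Q refl = refl
  final-split (p ∷ P) Q refl = final-++ p P _ Q

  ¬All¬⇒Any : ∀ {p} {P : A → Set p} → Decidable P → ∀ xs → ¬ All (¬_ ∘ P) xs → Any P xs
  ¬All¬⇒Any P? xs not-all = [ ⊥-elim ∘ not-all , id ]′ (All.search P? xs)

  AllPairs-with : ∀ {q r} {Q : A → Set q} {R : A → A → Set r} {xs} → All Q xs → AllPairs R xs →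
    AllPairs (λ a b → Q a × Q b × R a b) xs
  AllPairs-with []       []       = []
  AllPairs-with (q ∷ qs) (r ∷ rs) = All.zipWith (λ (q′ , r′) → q , q′ , r′) (qs , r) ∷ AllPairs-with qs rs

unique-concat⁻ : ∀ {a b} {A : Set a} {B : Set b} (f : B → List A) ps → Unique (concatMap f ps) →
  AllPairs (λ p q → ∀ {x} → x ∈ f p → x ∉ f q) ps
unique-concat⁻ f []       _ = []
unique-concat⁻ f (p ∷ ps) u with _ , u-rest , disj ← unique-++⁻ (f p) u =
  All.tabulate (λ q∈ x∈p x∈q → disj x∈p (∈-concat⁺′ x∈q (∈-map⁺ f q∈))) ∷ unique-concat⁻ f ps u-rest

final-map : ∀ {a b} {A : Set a} {B : Set b} (f : A → B) x xs → final (f x) (map f xs) ≡ f (final x xs)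
final-map f x []       = refl
final-map f x (y ∷ ys) = final-map f y ys

-- Counting arguments modulo an equivalence relation.
module Counting {c ℓ : Level} (𝒮 : Setoid c ℓ) where

  open Setoid 𝒮 using (_≈_) renaming (Carrier to A; sym to ≈-sym; trans to ≈-trans)
  open import Data.List.Membership.Setoid 𝒮 using () renaming (_∈_ to _∈≈_)
  open import Data.List.Relation.Unary.Unique.Setoid 𝒮 using () renaming (Unique to Unique≈)

  private
    split : ∀ {x ys} → x ∈≈ ys → ∃[ P ] ∃[ y ] ∃[ Q ] (ys ≡ P ++ y ∷ Q) × (x ≈ y)
    split {ys = y ∷ ys} (here x≈y) = [] , y , ys , refl , x≈y
    split {ys = y ∷ ys} (there x∈) with P , z , Q , refl , x≈z ← split x∈ =
      y ∷ P , z , Q , refl , x≈z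

    stay : ∀ {x y} P Q → x ∈≈ P ++ y ∷ Q → ¬ x ≈ y → x ∈≈ P ++ Q
    stay []      Q (here x≈y) x≉y = ⊥-elim (x≉y x≈y)
    stay []      Q (there x∈) _   = x∈
    stay (p ∷ P) Q (here x≈p) _   = here x≈p
    stay (p ∷ P) Q (there x∈) x≉y = there (stay P Q x∈ x≉y)

  pigeonhole : ∀ {xs ys} → Unique≈ xs → All (_∈≈ ys) xs → length xs ≤ length ys
  pigeonhole {[]}     _             _          = z≤n
  pigeonhole {x ∷ xs} (x≉xs ∷ uxs) (x∈ ∷ xs∈)
    with P , y , Q , refl , x≈y ← split x∈ =
    ≤-trans (s≤s (pigeonhole uxs (All.zipWith keep (x≉xs , xs∈))))
            (≤-reflexive (sym (length-insert y P Q)))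
    where
    keep : ∀ {z} → ¬ x ≈ z × z ∈≈ P ++ y ∷ Q → z ∈≈ P ++ Q
    keep (x≉z , z∈) = stay P Q z∈ (λ z≈y → x≉z (≈-trans x≈y (≈-sym z≈y)))

  Disjoint : List A → List A → Set (c Level.⊔ ℓ)
  Disjoint xs ys = All (λ x → All (λ y → ¬ x ≈ y) ys) xs

  -- Weak duality: pairwise disjoint lists, each meeting C, are at most
  -- |C| many.  (Every family of disjoint paths is bounded by every
  -- separator.)
  hitting-bound : {b : Level} {B : Set b} (f : B → List A) (C : List A) {ws : List B} →
    AllPairs (λ v w → Disjoint (f v) (f w)) ws → All (λ w → Any (_∈≈ C) (f w)) ws →
    length ws ≤ length C
  hitting-bound f C [] [] = z≤n
  hitting-bound f C {w ∷ ws} (d ∷ ds) (h ∷ hs)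
    with s , s∈w , s∈C ← find h
    with P , y , Q , refl , s≈y ← split s∈C =
    ≤-trans (s≤s (hitting-bound f (P ++ Q) ds (All.zipWith shrink (d , hs))))
            (≤-reflexive (sym (length-insert y P Q)))
    where
    shrink : ∀ {v} → Disjoint (f w) (f v) × Any (_∈≈ P ++ y ∷ Q) (f v) → Any (_∈≈ P ++ Q) (f v)
    shrink (dv , hv) with r , r∈v , r∈C ← find hv =
      lose r∈v
        (stay P Q r∈C (λ r≈y → All.lookup (All.lookup dv s∈w) r∈v (≈-trans s≈y (≈-sym r≈y))))

-- Walks in a digraph whose vertices have decidable equality.  A walk
-- x ∷ xs is given by its vertex sequence.

module Walks {V : Set} (_≟_ : DecidableEquality V) where

  open import Data.List.Membership.DecPropositional _≟_ using (_∈?_)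
  open import Data.List.Relation.Unary.Unique.DecPropositional.Properties _≟_ using (deduplicate-!)

  Edge : Set
  Edge = V × V

  _≟E_ : DecidableEquality Edge
  _≟E_ = ≡-dec _≟_ _≟_

  open import Data.List.Membership.DecPropositional _≟E_ using () renaming (_∈?_ to _∈E?_)
  open import Data.List.Relation.Unary.Unique.DecPropositional.Properties _≟E_ using ()
    renaming (deduplicate-! to deduplicateE-!)

  steps : List V → List Edge
  steps []           = []
  steps (x ∷ [])     = []
  steps (x ∷ y ∷ xs) = (x , y) ∷ steps (y ∷ xs)

  final-steps : ∀ x y ys → proj₂ (final (x , y) (steps (y ∷ ys))) ≡ final y ys
  final-steps x y []       = refl
  final-steps x y (z ∷ zs) = final-steps y z zs

  steps-∈ : ∀ {a b} xs → (a , b) ∈ steps xs → a ∈ xs × b ∈ xs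
  steps-∈ (x ∷ y ∷ xs) (here refl) = here refl , there (here refl)
  steps-∈ (x ∷ y ∷ xs) (there e∈) = Product.map there there (steps-∈ (y ∷ xs) e∈)

  steps-suffix : ∀ P y Q → steps (y ∷ Q) ⊆ steps (P ++ y ∷ Q)
  steps-suffix []          y Q e∈ = e∈
  steps-suffix (x ∷ [])    y Q e∈ = there e∈
  steps-suffix (x ∷ z ∷ P) y Q e∈ = there (steps-suffix (z ∷ P) y Q e∈)

  steps-snoc : ∀ x xs c → steps (x ∷ xs ++ [ c ]) ≡ steps (x ∷ xs) ++ [ (final x xs , c) ]
  steps-snoc x []       c = refl
  steps-snoc x (y ∷ ys) c = cong ((x , y) ∷_) (steps-snoc y ys c)

  Linked⇒steps : ∀ {R : V → V → Set} xs → Linked R xs → All (Product.uncurry R) (steps xs)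
  Linked⇒steps []           _         = []
  Linked⇒steps (x ∷ [])     _         = []
  Linked⇒steps (x ∷ y ∷ xs) (r ∷ rs) = r ∷ Linked⇒steps (y ∷ xs) rs

  steps⇒Linked : ∀ {R : V → V → Set} xs → All (Product.uncurry R) (steps xs) → Linked R xs
  steps⇒Linked []           _         = []
  steps⇒Linked (x ∷ [])     _         = [-]
  steps⇒Linked (x ∷ y ∷ xs) (r ∷ rs) = r ∷ steps⇒Linked (y ∷ xs) rs

  steps-unique : ∀ xs → Unique xs → Unique (steps xs)
  steps-unique []           _          = []
  steps-unique (x ∷ [])     _          = []
  steps-unique (x ∷ y ∷ xs) (x∉ ∷ u) =
    All.tabulate (λ e∈ → fresh e∈) ∷ steps-unique (y ∷ xs) u
    where
    fresh : ∀ {e} → e ∈ steps (y ∷ xs) → ¬ (x , y) ≡ e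
    fresh e∈ refl = All.lookup x∉ (proj₁ (steps-∈ (y ∷ xs) e∈)) refl

  erase-loops : ∀ x xs →
    ∃[ ys ] (final x ys ≡ final x xs) × Unique (x ∷ ys) × steps (x ∷ ys) ⊆ steps (x ∷ xs)
  erase-loops x []       = [] , refl , [] ∷ [] , id
  erase-loops x (y ∷ xs) with zs , fin , uzs , sub ← erase-loops y xs with x ∈? (y ∷ zs)
  ... | no x∉ = y ∷ zs , fin , ¬Any⇒All¬ _ x∉ ∷ uzs ,
                λ { (here e) → here e ; (there e∈) → there (sub e∈) }
  ... | yes x∈ with P , Q , eq ← ∈-∃++ x∈ =
    Q , trans (sym (final-split P Q eq)) fin ,
    proj₁ (proj₂ (unique-++⁻ P (subst Unique eq uzs))) ,
    λ e∈ → there (sub (subst (λ l → _ ∈ steps l) (sym eq) (steps-suffix P x Q e∈)))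

  module Menger (E : List Edge) (S : List V) (t : V) (t∉S : t ∉ S) where

    open PermutationReasoning

    -- Flow conservation is bookkept as a permutation between the multiset
    -- of heads and the multiset of tails of the used edges; sources are
    -- exempt, so each vertex v contributes  keep v.
    keep : V → List V
    keep v with v ∈? S
    ... | yes _ = []
    ... | no  _ = [ v ]

    keep-source : ∀ {v} → v ∈ S → keep v ≡ []
    keep-source {v} v∈S with v ∈? S
    ... | yes _   = refl
    ... | no  v∉S = ⊥-elim (v∉S v∈S)

    keep-inner : ∀ {v} → v ∉ S → keep v ≡ [ v ]
    keep-inner {v} v∉S with v ∈? S
    ... | yes v∈S = ⊥-elim (v∉S v∈S)
    ... | no  _   = refl

    keep-⊆ : ∀ {c v} → c ∈ keep v → c ≡ v
    keep-⊆ {v = v} c∈ with v ∈? S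
    keep-⊆ ()          | yes _
    keep-⊆ (here c≡v)  | no  _ = c≡v

    drop-keep : ∀ {v} → v ∈ S → ∀ R → R ++ keep v ≡ R
    drop-keep v∈S R = trans (cong (R ++_) (keep-source v∈S)) (++-identityʳ R)

    c∈keep : ∀ {c} → c ∉ S → c ∈ keep c
    c∈keep c∉S = subst (_ ∈_) (sym (keep-inner c∉S)) (here refl)

    ends : (Edge → V) → List Edge → List V
    ends f []      = []
    ends f (e ∷ U) = keep (f e) ++ ends f U

    heads tails : List Edge → List V
    heads = ends proj₂
    tails = ends proj₁

    ends-++ : ∀ f U W → ends f (U ++ W) ≡ ends f U ++ ends f W
    ends-++ f []      W = refl
    ends-++ f (e ∷ U) W =
      trans (cong (keep (f e) ++_) (ends-++ f U W)) (sym (++-assoc (keep (f e)) (ends f U) _))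

    ends-↭ : ∀ f {U W} → U ↭ W → ends f U ↭ ends f W
    ends-↭ f Perm.refl        = ↭-refl
    ends-↭ f (prep e p)       = ++⁺ˡ (keep (f e)) (ends-↭ f p)
    ends-↭ f (swap e e′ p)    =
      ↭-trans (shifts (keep (f e)) (keep (f e′))) (++⁺ˡ (keep (f e′)) (++⁺ˡ (keep (f e)) (ends-↭ f p)))
    ends-↭ f (Perm.trans p q) = ↭-trans (ends-↭ f p) (ends-↭ f q)

    head-of : ∀ {c} U → c ∈ heads U → ∃[ a ] (a , c) ∈ U
    head-of ((a , b) ∷ U) c∈ with ∈-++⁻ (keep b) c∈
    ... | inj₁ c∈b with refl ← keep-⊆ c∈b = a , here refl
    ... | inj₂ c∈U = Product.map₂ there (head-of U c∈U)

    -- U carries a flow of value k: conservation holds at every vertex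
    -- except the sources and t, which has k more incoming edges.
    Flow : List Edge → ℕ → Set
    Flow U k = heads U ↭ tails U ++ replicate k t

    walk-balance : ∀ x xs →
      heads (steps (x ∷ xs)) ++ keep x ↭ tails (steps (x ∷ xs)) ++ keep (final x xs)
    walk-balance x []       = ↭-refl
    walk-balance x (y ∷ ys) = begin
      (keep y ++ heads A) ++ keep x            ↭⟨ PermP.++-comm (keep y ++ heads A) (keep x) ⟩
      keep x ++ keep y ++ heads A              ↭⟨ ++⁺ˡ (keep x) (PermP.++-comm (keep y) (heads A)) ⟩
      keep x ++ heads A ++ keep y              ↭⟨ ++⁺ˡ (keep x) (walk-balance y ys) ⟩
      keep x ++ tails A ++ keep (final y ys)   ≡⟨ ++-assoc (keep x) (tails A) _ ⟨
      (keep x ++ tails A) ++ keep (final y ys) ∎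
      where
      A : List Edge
      A = steps (y ∷ ys)

    edgesOf : List⁺ V → List Edge
    edgesOf p = steps (toList p)

    IsRoute : List⁺ V → Set
    IsRoute p = (head p ∈ S) × (last p ≡ t) × Unique (toList p) × All (_∈ E) (edgesOf p)

    route-flow : ∀ p → IsRoute p → Flow (edgesOf p) 1
    route-flow (x ∷ xs) (x∈S , last≡t , _) = begin
      heads A                       ≡⟨ ++-identityʳ (heads A) ⟨
      heads A ++ []                 ≡⟨ cong (heads A ++_) (keep-source x∈S) ⟨
      heads A ++ keep x             ↭⟨ walk-balance x xs ⟩
      tails A ++ keep (final x xs)  ≡⟨ cong (λ v → tails A ++ keep v) final≡t ⟩
      tails A ++ keep t             ≡⟨ cong (tails A ++_) (keep-inner t∉S) ⟩
      tails A ++ [ t ]              ∎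
      where
      A : List Edge
      A = steps (x ∷ xs)
      final≡t : final x xs ≡ t
      final≡t = trans (sym (last≡final x xs)) last≡t

    route-nonempty : ∀ p → IsRoute p → 1 ≤ length (edgesOf p)
    route-nonempty (x ∷ [])    (x∈S , refl , _) = ⊥-elim (t∉S x∈S)
    route-nonempty (x ∷ y ∷ _) _                = s≤s z≤n

    family-flow : ∀ ps → All IsRoute ps → Flow (concatMap edgesOf ps) (length ps)
    family-flow []       []       = ↭-refl
    family-flow (p ∷ ps) (r ∷ rs) = begin
      heads (A ++ B)                      ≡⟨ ends-++ proj₂ A B ⟩
      heads A ++ heads B                  ↭⟨ ++⁺ (route-flow p r) (family-flow ps rs) ⟩
      (tails A ++ [ t ]) ++ tails B ++ R  ≡⟨ ++-assoc (tails A) [ t ] _ ⟩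
      tails A ++ [ t ] ++ tails B ++ R    ↭⟨ ++⁺ˡ (tails A) (shifts [ t ] (tails B)) ⟩
      tails A ++ tails B ++ t ∷ R         ≡⟨ ++-assoc (tails A) (tails B) _ ⟨
      (tails A ++ tails B) ++ t ∷ R       ≡⟨ cong (_++ t ∷ R) (ends-++ proj₁ A B) ⟨
      tails (A ++ B) ++ t ∷ R             ∎
      where
      A B : List Edge
      A = edgesOf p
      B = concatMap edgesOf ps
      R : List V
      R = replicate (length ps) t

    Residual : List Edge → Edge → Set
    Residual U (u , v) = ((u , v) ∈ E × (u , v) ∉ U) ⊎ ((v , u) ∈ U)

    add-edge : ∀ x y U R → heads U ↭ tails U ++ R ++ keep x →
      heads ((x , y) ∷ U) ↭ tails ((x , y) ∷ U) ++ R ++ keep y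
    add-edge x y U R bal = begin
      keep y ++ heads U                   ↭⟨ ++⁺ˡ (keep y) bal ⟩
      keep y ++ tails U ++ R ++ keep x    ≡⟨ cong (keep y ++_) (++-assoc (tails U) R (keep x)) ⟨
      keep y ++ (tails U ++ R) ++ keep x  ↭⟨ exchange (keep y) (tails U ++ R) (keep x) ⟩
      keep x ++ (tails U ++ R) ++ keep y  ≡⟨ cong (keep x ++_) (++-assoc (tails U) R (keep y)) ⟩
      keep x ++ tails U ++ R ++ keep y    ≡⟨ ++-assoc (keep x) (tails U) _ ⟨
      (keep x ++ tails U) ++ R ++ keep y  ∎

    drop-edge : ∀ a c P Q R →
      heads (P ++ (a , c) ∷ Q) ↭ tails (P ++ (a , c) ∷ Q) ++ R ++ keep c →
      heads (P ++ Q) ↭ tails (P ++ Q) ++ R ++ keep a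
    drop-edge a c P Q R bal = ↭-cancelˡ (keep c) (begin
      keep c ++ heads W                        ↭⟨ ends-↭ proj₂ (shift (a , c) P Q) ⟨
      heads (P ++ (a , c) ∷ Q)                 ↭⟨ bal ⟩
      tails (P ++ (a , c) ∷ Q) ++ R ++ keep c  ↭⟨ ++⁺ʳ (R ++ keep c) (ends-↭ proj₁ (shift (a , c) P Q)) ⟩
      (keep a ++ tails W) ++ R ++ keep c       ≡⟨ ++-assoc (keep a) (tails W) _ ⟩
      keep a ++ tails W ++ R ++ keep c         ≡⟨ cong (keep a ++_) (++-assoc (tails W) R (keep c)) ⟨
      keep a ++ (tails W ++ R) ++ keep c       ↭⟨ exchange (keep a) (tails W ++ R) (keep c) ⟩
      keep c ++ (tails W ++ R) ++ keep a       ≡⟨ cong (keep c ++_) (++-assoc (tails W) R (keep a)) ⟩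
      keep c ++ tails W ++ R ++ keep a         ∎)
      where
      W : List Edge
      W = P ++ Q

    residual-add : ∀ {x y ys U} → All (λ z → ¬ x ≡ z) (y ∷ ys) →
      All (Residual U) (steps (y ∷ ys)) → All (Residual ((x , y) ∷ U)) (steps (y ∷ ys))
    residual-add {x} {y} {ys} {U} x∉ res = All.tabulate (λ e∈ → still e∈ (All.lookup res e∈))
      where
      still : ∀ {e} → e ∈ steps (y ∷ ys) → Residual U e → Residual ((x , y) ∷ U) e
      still e∈ (inj₁ (e∈E , e∉U)) = inj₁ (e∈E , λ
        { (here refl) → All.lookup x∉ (proj₁ (steps-∈ (y ∷ ys) e∈)) refl
        ; (there e∈U) → e∉U e∈U })
      still e∈ (inj₂ back) = inj₂ (there back)

    residual-drop : ∀ {x y ys} P Q → All (λ z → ¬ x ≡ z) (y ∷ ys) →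
      All (Residual (P ++ (y , x) ∷ Q)) (steps (y ∷ ys)) → All (Residual (P ++ Q)) (steps (y ∷ ys))
    residual-drop {x} {y} {ys} P Q x∉ res = All.tabulate (λ e∈ → still e∈ (All.lookup res e∈))
      where
      still : ∀ {e} → e ∈ steps (y ∷ ys) → Residual (P ++ (y , x) ∷ Q) e → Residual (P ++ Q) e
      still e∈ (inj₁ (e∈E , e∉U)) = inj₁ (e∈E , e∉U ∘ ∈-insert P Q)
      still e∈ (inj₂ back) =
        inj₂ (∈-delete P Q back λ { refl → All.lookup x∉ (proj₁ (steps-∈ (y ∷ ys) e∈)) refl })

    augment : ∀ x xs U R → Unique (x ∷ xs) → All (Residual U) (steps (x ∷ xs)) →
      Unique U → All (_∈ E) U → heads U ↭ tails U ++ R ++ keep x →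
      ∃[ U′ ] Unique U′ × All (_∈ E) U′ × (heads U′ ↭ tails U′ ++ R ++ keep (final x xs))
    augment x [] U R _ _ uU U⊆E bal = U , uU , U⊆E , bal
    augment x (y ∷ ys) U R (x∉ ∷ u) (inj₁ (xy∈E , xy∉U) ∷ res) uU U⊆E bal =
      augment y ys ((x , y) ∷ U) R u (residual-add x∉ res)
        (¬Any⇒All¬ U xy∉U ∷ uU) (xy∈E ∷ U⊆E) (add-edge x y U R bal)
    augment x (y ∷ ys) U R (x∉ ∷ u) (inj₂ yx∈U ∷ res) uU U⊆E bal
      with P , Q , refl ← ∈-∃++ yx∈U =
      augment y ys (P ++ Q) R u (residual-drop P Q x∉ res)
        (unique-delete P Q uU) (anti-mono (∈-insert P Q) U⊆E) (drop-edge y x P Q R bal)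

    prolong : ∀ s ws {a c U′} P Q → final s ws ≡ a → steps (s ∷ ws) ++ U′ ↭ P ++ Q →
      steps (s ∷ ws ++ [ c ]) ++ U′ ↭ P ++ (a , c) ∷ Q
    prolong s ws {a} {c} {U′} P Q refl split = begin
      steps (s ∷ ws ++ [ c ]) ++ U′  ≡⟨ cong (_++ U′) (steps-snoc s ws c) ⟩
      (A ++ [ (a , c) ]) ++ U′       ≡⟨ ++-assoc A [ (a , c) ] U′ ⟩
      A ++ (a , c) ∷ U′              ↭⟨ shift (a , c) A U′ ⟩
      (a , c) ∷ A ++ U′              ↭⟨ prep (a , c) split ⟩
      (a , c) ∷ P ++ Q               ↭⟨ shift (a , c) P Q ⟨
      P ++ (a , c) ∷ Q               ∎
      where
      A : List Edge
      A = steps (s ∷ ws)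

    WalkTo : V → Set
    WalkTo c = ∃[ s ] ∃[ ws ] (s ∈ S) × (final s ws ≡ c)

    -- A partial flow with surplus at the inner vertex c contains a walk from
    -- a source to c; removing it leaves a partial flow without that surplus.
    extract : ∀ n U c R → length U ≡ n → c ∉ S → heads U ↭ tails U ++ R ++ keep c →
      Σ (WalkTo c) λ (s , ws , _) →
        ∃[ U′ ] (steps (s ∷ ws) ++ U′ ↭ U) × (heads U′ ↭ tails U′ ++ R)
    extract n U c R len c∉S bal
      with a , ac∈U ← head-of U (∈-resp-↭ (↭-sym bal) (∈-++⁺ʳ (tails U) (∈-++⁺ʳ R (c∈keep c∉S))))
      with P , Q , refl ← ∈-∃++ ac∈U
      with a ∈? S | n
    ... | _       | zero  = ⊥-elim (0≢1+n (trans (sym len) (length-insert (a , c) P Q)))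
    ... | yes a∈S | suc _ =
      (a , [ c ] , a∈S , refl) , P ++ Q , ↭-sym (shift (a , c) P Q) ,
      ↭-trans (drop-edge a c P Q R bal) (↭-reflexive (cong (tails (P ++ Q) ++_) (drop-keep a∈S R)))
    ... | no a∉S  | suc m
      with (s , ws , s∈S , ws→a) , U′ , split , balU′ ←
        extract m (P ++ Q) a R (suc-injective (trans (sym (length-insert (a , c) P Q)) len)) a∉S
          (drop-edge a c P Q R bal) =
      (s , ws ++ [ c ] , s∈S , final-++ s ws c []) , U′ , prolong s ws P Q ws→a split , balU′

    IsWalkToT : List⁺ V → Set
    IsWalkToT w = (head w ∈ S) × (last w ≡ t)

    surplus-at-t : ∀ k U → tails U ++ replicate (suc k) t ↭ tails U ++ replicate k t ++ keep t
    surplus-at-t k U = begin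
      tails U ++ t ∷ replicate k t       ↭⟨ ++⁺ˡ (tails U) (PermP.++-comm [ t ] (replicate k t)) ⟩
      tails U ++ replicate k t ++ [ t ]  ≡⟨ cong (λ r → tails U ++ replicate k t ++ r) (keep-inner t∉S) ⟨
      tails U ++ replicate k t ++ keep t ∎

    flow-at-source : ∀ U k {s} → s ∈ S → Flow U k → heads U ↭ tails U ++ replicate k t ++ keep s
    flow-at-source U k {s} s∈S flow =
      ↭-trans flow (↭-reflexive (cong (tails U ++_) (sym (drop-keep s∈S (replicate k t)))))

    surplus-flow : ∀ U k {v} → v ≡ t → heads U ↭ tails U ++ replicate k t ++ keep v → Flow U (suc k)
    surplus-flow U k refl bal = ↭-trans bal (↭-sym (surplus-at-t k U))

    decompose : ∀ k U → Flow U k →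
      ∃[ ws ] (length ws ≡ k) × All IsWalkToT ws × ∃[ U′ ] (concatMap edgesOf ws ++ U′ ↭ U)
    decompose zero    U _    = [] , refl , [] , U , ↭-refl
    decompose (suc k) U flow
      with (s , ws , s∈S , ws→t) , U₁ , split , flow₁ ←
             extract (length U) U t (replicate k t) refl t∉S (↭-trans flow (surplus-at-t k U))
      with ws′ , len , walks , U′ , split′ ← decompose k U₁ flow₁ =
      (s ∷ ws) ∷ ws′ , cong suc len , (s∈S , trans (last≡final s ws) ws→t) ∷ walks , U′ ,
      ↭-trans (↭-reflexive (++-assoc (steps (s ∷ ws)) _ U′)) (↭-trans (++⁺ˡ (steps (s ∷ ws)) split′) split)

    routes-from-walks : ∀ ws → All IsWalkToT ws → Unique (concatMap edgesOf ws) →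
      All (_∈ E) (concatMap edgesOf ws) →
      ∃[ ps ] (length ps ≡ length ws) × All IsRoute ps × Unique (concatMap edgesOf ps) ×
              (concatMap edgesOf ps ⊆ concatMap edgesOf ws)
    routes-from-walks []              []                       _ _  = [] , refl , [] , [] , id
    routes-from-walks ((s ∷ xs) ∷ ws) ((s∈S , last≡t) ∷ walks) u ⊆E
      with _ , uB , disj ← unique-++⁻ (steps (s ∷ xs)) u
      with ys , fin , uys , sub ← erase-loops s xs
      with ps , len , routes , ups , subps ←
             routes-from-walks ws walks uB (AllP.++⁻ʳ (steps (s ∷ xs)) ⊆E) =
      (s ∷ ys) ∷ ps , cong suc len , route ∷ routes ,
      unique-++⁺ (steps-unique (s ∷ ys) uys) ups (λ a∈ a∈′ → disj (sub a∈) (subps a∈′)) ,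
      λ a∈ → [ ∈-++⁺ˡ ∘ sub , ∈-++⁺ʳ _ ∘ subps ]′ (∈-++⁻ (steps (s ∷ ys)) a∈)
      where
      route : IsRoute (s ∷ ys)
      route = s∈S , trans (last≡final s ys) (trans fin (trans (sym (last≡final s xs)) last≡t)) ,
              uys , anti-mono sub (AllP.++⁻ˡ (steps (s ∷ xs)) ⊆E)

    routes⊆E : ∀ ps → All IsRoute ps → All (_∈ E) (concatMap edgesOf ps)
    routes⊆E ps routes = AllP.concat⁺ (AllP.map⁺ (All.map (λ r → proj₂ (proj₂ (proj₂ r))) routes))

    routes-bound : ∀ ps → All IsRoute ps → Unique (concatMap edgesOf ps) → length ps ≤ length E
    routes-bound ps routes u = ≤-trans (one-each ps routes) (pigeonhole u (routes⊆E ps routes))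
      where
      open Counting (setoid Edge) using (pigeonhole)
      one-each : ∀ ps → All IsRoute ps → length ps ≤ length (concatMap edgesOf ps)
      one-each []       []       = z≤n
      one-each (p ∷ ps) (r ∷ rs) = ≤-trans (+-mono-≤ (route-nonempty p r) (one-each ps rs))
                                           (≤-reflexive (sym (length-++ (edgesOf p))))

    Closed : List Edge → List V → Set
    Closed U X = ∀ {u v} → u ∈ X → Residual U (u , v) → v ∈ X

    -- Exploring the residual graph of the used edges U ⊆ E: either t is
    -- reachable from a source, or a closed set separates the sources from t.
    module Explore (U : List Edge) (U⊆E : All (_∈ E) U) where

      Reachable : V → Set
      Reachable v = ∃[ s ] ∃[ ws ] (s ∈ S) × (final s ws ≡ v) × All (Residual U) (steps (s ∷ ws))

      extend : ∀ {a b} → Reachable a → Residual U (a , b) → Reachable b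
      extend {a} {b} (s , ws , s∈S , ws→a , res) r =
        s , ws ++ [ b ] , s∈S , final-++ s ws b [] ,
        subst (All (Residual U)) (sym (steps-snoc s ws b))
          (AllP.++⁺ res (subst (λ v → Residual U (v , b)) (sym ws→a) r ∷ []))

      Exit : List V → Edge → Set
      Exit X (a , b) = (a ∈ X × b ∉ X × (a , b) ∉ U) ⊎ ((a , b) ∈ U × b ∈ X × a ∉ X)

      exit? : ∀ X e → Dec (Exit X e)
      exit? X (a , b) = (a ∈? X ×-dec ¬? (b ∈? X) ×-dec ¬? ((a , b) ∈E? U))
                 ⊎-dec ((a , b) ∈E? U ×-dec b ∈? X ×-dec ¬? (a ∈? X))

      -- every residual edge comes from E, so without exits X is closed
      closed-if-no-exit : ∀ X → ¬ Any (Exit X) E → Closed U X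
      closed-if-no-exit X none {u} {v} u∈X res with v ∈? X | res
      ... | yes v∈X | _                   = v∈X
      ... | no v∉X  | inj₁ (uv∈E , uv∉U) = ⊥-elim (none (lose uv∈E (inj₁ (u∈X , v∉X , uv∉U))))
      ... | no v∉X  | inj₂ vu∈U          =
        ⊥-elim (none (lose (All.lookup U⊆E vu∈U) (inj₂ (vu∈U , u∈X , v∉X))))

      vertices : List V
      vertices = S ++ map proj₁ E ++ map proj₂ E

      new-vertex : ∀ X → (∀ {x} → x ∈ X → Reachable x) → Any (Exit X) E →
        ∃[ v ] (v ∉ X) × (v ∈ vertices) × Reachable v
      new-vertex X reach ex with (a , b) , e∈E , exit ← find ex with exit
      ... | inj₁ (a∈X , b∉X , ab∉U) =
        b , b∉X , ∈-++⁺ʳ S (∈-++⁺ʳ _ (∈-map⁺ proj₂ e∈E)) , extend (reach a∈X) (inj₁ (e∈E , ab∉U))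
      ... | inj₂ (ab∈U , b∈X , a∉X) =
        a , a∉X , ∈-++⁺ʳ S (∈-++⁺ˡ (∈-map⁺ proj₁ e∈E)) , extend (reach b∈X) (inj₂ ab∈U)

      Outcome : Set
      Outcome = Reachable t ⊎ (∃[ X ] (S ⊆ X) × (t ∉ X) × Closed U X)

      -- grow a set of reachable vertices until it is closed; it can grow
      -- only |vertices| times
      grow : ∀ fuel X → Unique X → All (_∈ vertices) X → (∀ {x} → x ∈ X → Reachable x) →
        S ⊆ X → length vertices < length X + fuel → Outcome
      grow zero X uX X⊆ reach S⊆X bound =
        ⊥-elim (<⇒≱ (subst (length vertices <_) (+-identityʳ _) bound) (pigeonhole uX X⊆))
        where open Counting (setoid V) using (pigeonhole)
      grow (suc fuel) X uX X⊆ reach S⊆X bound with any? (exit? X) E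
      ... | yes ex with v , v∉X , v∈V , reach-v ← new-vertex X reach ex =
        grow fuel (v ∷ X) (¬Any⇒All¬ X v∉X ∷ uX) (v∈V ∷ X⊆)
          (λ { (here refl) → reach-v ; (there x∈) → reach x∈ }) (there ∘ S⊆X)
          (subst (length vertices <_) (+-suc (length X) fuel) bound)
      ... | no none with t ∈? X
      ...   | yes t∈X = inj₁ (reach t∈X)
      ...   | no  t∉X = inj₂ (X , S⊆X , t∉X , closed-if-no-exit X none)

      explore : Outcome
      explore = grow (suc (length vertices)) X₀ (deduplicate-! S)
        (All.tabulate (∈-++⁺ˡ ∘ ∈-deduplicate⁻ _≟_ S))
        (λ {x} x∈ → x , [] , ∈-deduplicate⁻ _≟_ S x∈ , refl , [])
        (∈-deduplicate⁺ _≟_)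
        (subst (length vertices <_) (sym (+-suc _ _)) (s≤s (m≤n+m _ _)))
        where
        X₀ : List V
        X₀ = deduplicate _≟_ S

    Separates : List Edge → Set
    Separates C = ∀ x xs → x ∈ S → final x xs ≡ t → All (_∈ E) (steps (x ∷ xs)) →
      Any (_∈ C) (steps (x ∷ xs))

    record Certificate : Set where
      field
        routes          : List (List⁺ V)
        cut             : List Edge
        routes-valid    : All IsRoute routes
        routes-disjoint : Unique (concatMap edgesOf routes)
        cut-unique      : Unique cut
        cut⊆E           : All (_∈ E) cut
        cut-separates   : Separates cut
        cut-small       : length cut ≤ length routes

    module Cut (X : List V) (S⊆X : S ⊆ X) (t∉X : t ∉ X) where

      Crossing : Edge → Set
      Crossing (a , b) = a ∈ X × b ∉ X

      crossing? : ∀ e → Dec (Crossing e)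
      crossing? (a , b) = a ∈? X ×-dec ¬? (b ∈? X)

      cut : List Edge
      cut = deduplicate _≟E_ (filter crossing? E)

      cut-crossing : ∀ {e} → e ∈ cut → e ∈ E × Crossing e
      cut-crossing e∈ = ∈-filter⁻ (setoid Edge) crossing? (λ { refl c → c }) (∈-deduplicate⁻ _≟E_ _ e∈)

      -- the first step of a walk leaving X (meaningful only for walks from
      -- X ending outside X, see exit-crossing)
      exit : V → List V → Edge
      exit x []       = (x , x)
      exit x (y ∷ ys) with y ∈? X
      ... | yes _ = exit y ys
      ... | no  _ = (x , y)

      exit-crossing : ∀ x xs → x ∈ X → final x xs ∉ X → exit x xs ∈ steps (x ∷ xs) × Crossing (exit x xs)
      exit-crossing x []       x∈X end∉X = ⊥-elim (end∉X x∈X)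
      exit-crossing x (y ∷ ys) x∈X end∉X with y ∈? X
      ... | yes y∈X = Product.map₁ there (exit-crossing y ys y∈X end∉X)
      ... | no  y∉X = here refl , x∈X , y∉X

      cut-separates : Separates cut
      cut-separates x xs x∈S end≡t ⊆E
        with e∈ , crossing ← exit-crossing x xs (S⊆X x∈S) (λ end∈X → t∉X (subst (_∈ X) end≡t end∈X)) =
        lose e∈ (∈-deduplicate⁺ _≟E_ (∈-filter⁺ (setoid Edge) crossing? (λ { refl c → c })
                                        (All.lookup ⊆E e∈) crossing))

      module _ {U : List Edge} (closed : Closed U X) where

        stays-outside : ∀ y ys → y ∉ X → steps (y ∷ ys) ⊆ U → ∀ {e} → e ∈ steps (y ∷ ys) → proj₁ e ∉ X
        stays-outside y (z ∷ zs) y∉X ⊆U (here refl) = y∉X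
        stays-outside y (z ∷ zs) y∉X ⊆U (there e∈)  =
          stays-outside z zs (λ z∈X → y∉X (closed z∈X (inj₂ (⊆U (here refl))))) (⊆U ∘ there) e∈

        crossing-is-exit : ∀ x xs → steps (x ∷ xs) ⊆ U → ∀ {e} → e ∈ steps (x ∷ xs) → Crossing e →
          e ≡ exit x xs
        crossing-is-exit x (y ∷ ys) ⊆U e∈ cr with y ∈? X
        crossing-is-exit x (y ∷ ys) ⊆U (here refl) (_ , y∉X)   | yes y∈X = ⊥-elim (y∉X y∈X)
        crossing-is-exit x (y ∷ ys) ⊆U (there e∈)  cr          | yes _   =
          crossing-is-exit y ys (⊆U ∘ there) e∈ cr
        crossing-is-exit x (y ∷ ys) ⊆U (here refl) _           | no _    = refl
        crossing-is-exit x (y ∷ ys) ⊆U (there e∈)  (a∈X , _)   | no y∉X  =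
          ⊥-elim (stays-outside y ys y∉X (⊆U ∘ there) e∈ a∈X)

        crossing-used : ∀ {e} → e ∈ E → Crossing e → e ∈ U
        crossing-used {a , b} e∈E (a∈X , b∉X) with (a , b) ∈E? U
        ... | yes e∈U = e∈U
        ... | no  e∉U = ⊥-elim (b∉X (closed a∈X (inj₁ (e∈E , e∉U))))

      -- For a closed set of the residual graph of k arc-disjoint routes,
      -- every cut edge is the exit of one of the routes, so |cut| ≤ k.
      certificate : ∀ ps → All IsRoute ps → Unique (concatMap edgesOf ps) →
        Closed (concatMap edgesOf ps) X → Certificate
      certificate ps routes u closed = record
        { routes          = ps
        ; cut             = cut
        ; routes-valid    = routes
        ; routes-disjoint = u
        ; cut-unique      = deduplicateE-! (filter crossing? E)
        ; cut⊆E           = All.tabulate (proj₁ ∘ cut-crossing)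
        ; cut-separates   = cut-separates
        ; cut-small       = ≤-trans (pigeonhole (deduplicateE-! (filter crossing? E)) (All.tabulate cut⊆exits))
                                    (≤-reflexive (length-map exitOf ps))
        }
        where
        open Counting (setoid Edge) using (pigeonhole)
        exitOf : List⁺ V → Edge
        exitOf p = exit (head p) (List⁺.tail p)
        on-route : ∀ qs → concatMap edgesOf qs ⊆ concatMap edgesOf ps → ∀ {e} →
          e ∈ concatMap edgesOf qs → Crossing e → e ∈ map exitOf qs
        on-route (q ∷ qs) ⊆U e∈ cr with ∈-++⁻ (edgesOf q) e∈
        ... | inj₁ e∈q  = here (crossing-is-exit closed (head q) (List⁺.tail q) (⊆U ∘ ∈-++⁺ˡ) e∈q cr)
        ... | inj₂ e∈qs = there (on-route qs (⊆U ∘ ∈-++⁺ʳ (edgesOf q)) e∈qs cr)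
        cut⊆exits : ∀ {e} → e ∈ cut → e ∈ map exitOf ps
        cut⊆exits e∈ with e∈E , cr ← cut-crossing e∈ = on-route ps id (crossing-used closed e∈E cr) cr

    -- Without a residual walk from S to t a closed
    -- set yields the certificate; otherwise the loop-erased walk raises the
    -- flow to value k + 1, which decomposes into k + 1 walks, hence routes.
    improve : ∀ ps → All IsRoute ps → Unique (concatMap edgesOf ps) →
      Certificate ⊎
      (∃[ ps′ ] (length ps′ ≡ suc (length ps)) × All IsRoute ps′ × Unique (concatMap edgesOf ps′))
    improve ps routes u with Explore.explore (concatMap edgesOf ps) (routes⊆E ps routes)
    ... | inj₂ (X , S⊆X , t∉X , closed) = inj₁ (Cut.certificate X S⊆X t∉X ps routes u closed)
    ... | inj₁ (s , ws , s∈S , ws→t , res)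
      with ys , fin , uys , sub ← erase-loops s ws
      with U′ , uU′ , U′⊆E , bal ←
             augment s ys (concatMap edgesOf ps) (replicate (length ps) t) uys (anti-mono sub res) u
               (routes⊆E ps routes)
               (flow-at-source (concatMap edgesOf ps) (length ps) s∈S (family-flow ps routes))
      with ws′ , len , walks , _ , split ←
             decompose (suc (length ps)) U′ (surplus-flow U′ (length ps) (trans fin ws→t) bal)
      with ps′ , len′ , routes′ , u′ , _ ←
             routes-from-walks ws′ walks
               (proj₁ (unique-++⁻ _ (unique-↭ (↭-sym split) uU′)))
               (AllP.++⁻ˡ _ (PermP.All-resp-↭ (↭-sym split) U′⊆E)) =
      inj₂ (ps′ , trans len′ len , routes′ , u′)

    -- repeat rounds; the number of routes is bounded by |E|
    iterate : ∀ fuel ps → All IsRoute ps → Unique (concatMap edgesOf ps) →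
      length E < length ps + fuel → Certificate
    iterate zero ps routes u bound =
      ⊥-elim (<⇒≱ (subst (length E <_) (+-identityʳ _) bound) (routes-bound ps routes u))
    iterate (suc fuel) ps routes u bound with improve ps routes u
    ... | inj₁ cert = cert
    ... | inj₂ (ps′ , len , routes′ , u′) =
      iterate fuel ps′ routes′ u′
        (subst (λ n → length E < n + fuel) (sym len) (subst (length E <_) (+-suc _ fuel) bound))

    menger : Certificate
    menger = iterate (suc (length E)) [] [] [] (s≤s ≤-refl)

_≟L_ : DecidableEquality Lit
mkLit v b ≟L mkLit w c with v ℕ≟ w | b Bool≟ c
... | yes refl | yes refl = yes refl
... | no v≢w   | _        = no λ { refl → v≢w refl }
... | yes _    | no b≢c   = no λ { refl → b≢c refl }

neg-involutive : ∀ l → neg (neg l) ≡ l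
neg-involutive (mkLit v b) = cong (mkLit v) (not-involutive b)

same-var : ∀ a b → var a ≡ var b → a ≡ b ⊎ a ≡ neg b
same-var (mkLit v b) (mkLit .v c) refl with b Bool≟ c
... | yes refl = inj₁ refl
... | no b≢c   = inj₂ (cong (mkLit v) (¬-not b≢c))

neg∈negs : ∀ {x L} → x ∈ negs L → neg x ∈ L
neg∈negs x∈ with l , l∈L , refl ← ∈-map⁻ neg x∈ = subst (_∈ _) (sym (neg-involutive l)) l∈L

clauseSetoid : Setoid 0ℓ 0ℓ
clauseSetoid = record
  { Carrier = Clause ; _≈_ = SameClause
  ; isEquivalence = record { refl = inj₁ refl ; sym = same-sym ; trans = same-trans } }
  where
  same-sym : ∀ {c d} → SameClause c d → SameClause d c
  same-sym (inj₁ refl) = inj₁ refl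
  same-sym (inj₂ refl) = inj₂ refl
  same-trans : ∀ {c d e} → SameClause c d → SameClause d e → SameClause c e
  same-trans (inj₁ refl) s           = s
  same-trans (inj₂ refl) (inj₁ refl) = inj₂ refl
  same-trans (inj₂ refl) (inj₂ refl) = inj₁ refl

_≟C_ : (c d : Clause) → Dec (SameClause c d)
c ≟C d = (c ≟LL d) ⊎-dec (swapC c ≟LL d)
  where
  _≟LL_ : DecidableEquality (Lit × Lit)
  _≟LL_ = ≡-dec _≟L_ _≟L_

clauseDecSetoid : DecSetoid 0ℓ 0ℓ
clauseDecSetoid = record
  { isDecEquivalence = record { isEquivalence = Setoid.isEquivalence clauseSetoid ; _≟_ = _≟C_ } }

open Walks _≟L_ using (_≟E_; steps; final-steps; steps-∈; steps-unique; Linked⇒steps; steps⇒Linked)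

arcsOf≡steps : ∀ xs → arcsOf xs ≡ steps xs
arcsOf≡steps []           = refl
arcsOf≡steps (x ∷ [])     = refl
arcsOf≡steps (x ∷ y ∷ xs) = cong ((x , y) ∷_) (arcsOf≡steps (y ∷ xs))

-- the clause (¬u ∨ v) and the arc u → v correspond to each other
dual : Lit × Lit → Lit × Lit
dual (a , b) = (neg a , b)

dual-involutive : ∀ e → dual (dual e) ≡ e
dual-involutive (a , b) = cong (_, b) (neg-involutive a)

clauseArcs : Clause → List Arc
clauseArcs c = dual c ∷ dual (swapC c) ∷ []

implicationArcs : TwoCNF → List Arc
implicationArcs F = concatMap clauseArcs (clauses F)

IsArc⇒∈ : ∀ F {e} → IsArc F e → e ∈ implicationArcs F
IsArc⇒∈ F = go (clauses F)
  where
  go : ∀ cs {e} → dual e ∈C cs → e ∈ concatMap clauseArcs cs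
  go (c ∷ cs) {e} (here (inj₁ eq)) = here (trans (sym (dual-involutive e)) (cong dual eq))
  go (c ∷ cs) {e} (here (inj₂ eq)) = there (here (trans (sym (dual-involutive e)) (cong (dual ∘ swapC) eq)))
  go (c ∷ cs) (there e∈) = ∈-++⁺ʳ (clauseArcs c) (go cs e∈)

∈⇒IsArc : ∀ F {e} → e ∈ implicationArcs F → IsArc F e
∈⇒IsArc F = go (clauses F)
  where
  go : ∀ cs {e} → e ∈ concatMap clauseArcs cs → dual e ∈C cs
  go (c ∷ cs) e∈ with ∈-++⁻ (clauseArcs c) e∈
  ... | inj₁ (here refl)         = here (inj₁ (dual-involutive c))
  ... | inj₁ (there (here refl)) = here (inj₂ (cong swapC (dual-involutive (swapC c))))
  ... | inj₂ e∈cs                = there (go cs e∈cs)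

Chained : Clause → Clause → Set
Chained s t = proj₂ s ≡ neg (proj₁ t)

-- The literal sequence ¬l₁, l₂, l₂′, … of a clause walk (l₁ ∨ l₂), (l₁′ ∨ l₂′), …
-- is a walk of the implication graph whose arcs are the duals of the clauses.
walkLits : List⁺ Clause → List⁺ Lit
walkLits (c ∷ cs) = neg (proj₁ c) ∷ map proj₂ (c ∷ cs)

walkLits-steps : ∀ c cs → Linked Chained (c ∷ cs) → steps (toList (walkLits (c ∷ cs))) ≡ map dual (c ∷ cs)
walkLits-steps c []        _        = refl
walkLits-steps c (c′ ∷ cs) (ch ∷ l) =
  cong (dual c ∷_) (trans (cong (λ v → steps (v ∷ map proj₂ (c′ ∷ cs))) ch) (walkLits-steps c′ cs l))

clausePath : List⁺ Lit → List⁺ Clause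
clausePath (x ∷ [])     = dual (x , x) ∷ []   -- not used: routes have an arc
clausePath (x ∷ y ∷ ys) = dual (x , y) ∷ map dual (steps (y ∷ ys))

-- consecutive duals of steps are chained: the second literal of (¬x ∨ y)
-- is the negation of the first literal of (¬y ∨ z)
clausePath-chained : ∀ x y ys → Linked Chained (map dual (steps (x ∷ y ∷ ys)))
clausePath-chained x y []       = [-]
clausePath-chained x y (z ∷ zs) = sym (neg-involutive y) ∷ clausePath-chained y z zs

clausePath-last : ∀ x y ys → proj₂ (last (clausePath (x ∷ y ∷ ys))) ≡ last (x ∷ y ∷ ys)
clausePath-last x y ys = begin
  proj₂ (last (dual (x , y) ∷ map dual A))       ≡⟨ cong proj₂ (last≡final (dual (x , y)) (map dual A)) ⟩
  proj₂ (final (dual (x , y)) (map dual A))      ≡⟨ cong proj₂ (final-map dual (x , y) A) ⟩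
  proj₂ (final (x , y) A)                         ≡⟨ final-steps x y ys ⟩
  final y ys                                      ≡⟨ last≡final x (y ∷ ys) ⟨
  last (x ∷ y ∷ ys)                               ∎
  where
  open ≡-Reasoning
  A : List Arc
  A = steps (y ∷ ys)

module Truth {F : TwoCNF} {P : List Lit} (sat : IsSatAssignment F P) where

  private
    consistent : NonContradictory P
    consistent = proj₁ sat

  arc-true : ∀ {u v} → u ∈ P → IsArc F (u , v) → v ∈ P
  arc-true {u} u∈P arc
    with c , c∈F , same ← find arc
    with All.lookup (proj₂ (proj₂ (proj₂ sat))) c∈F | same
  ... | inj₁ ¬u∈P | inj₁ refl = ⊥-elim (consistent u u∈P ¬u∈P)
  ... | inj₂ v∈P  | inj₁ refl = v∈P
  ... | inj₁ v∈P  | inj₂ refl = v∈P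
  ... | inj₂ ¬u∈P | inj₂ refl = ⊥-elim (consistent u u∈P ¬u∈P)

  walk-true : ∀ {x xs} → x ∈ P → Linked (λ u v → IsArc F (u , v)) (x ∷ xs) → All (_∈ P) (x ∷ xs)
  walk-true {xs = []}     x∈P _           = x∈P ∷ []
  walk-true {xs = y ∷ ys} x∈P (arc ∷ arcs) = x∈P ∷ walk-true (arc-true x∈P arc) arcs

  TrueArc : Arc → Set
  TrueArc (u , v) = u ∈ P × v ∈ P

  steps-true : ∀ xs → All (_∈ P) xs → All TrueArc (steps xs)
  steps-true xs all-true = All.tabulate λ e∈ →
    Product.map (All.lookup all-true) (All.lookup all-true) (steps-∈ xs e∈)

  -- The crux: the arcs u → v and ¬v → ¬u of one clause cannot both join
  -- true literals, so between true literals different arcs have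
  -- different clauses.
  dual-injective : ∀ {a b} → TrueArc a → TrueArc b → SameClause (dual a) (dual b) → a ≡ b
  dual-injective {a} {b} _ _ (inj₁ eq) =
    trans (sym (dual-involutive a)) (trans (cong dual eq) (dual-involutive b))
  dual-injective {b = b₁ , _} (_ , a₂∈P) (b₁∈P , _) (inj₂ eq) =
    ⊥-elim (consistent b₁ b₁∈P (subst (_∈ P) (cong proj₁ eq) a₂∈P))

  duals-distinct : ∀ {es} → All TrueArc es → Unique es → AllPairs (λ s t → ¬ SameClause s t) (map dual es)
  duals-distinct []         []        = []
  duals-distinct (ta ∷ tas) (a∉ ∷ u) =
    AllP.map⁺ (All.zipWith (λ (tb , a≢b) same → a≢b (dual-injective ta tb same)) (tas , a∉))
    ∷ duals-distinct tas u

  duals-disjoint : ∀ {es fs} → All TrueArc es → All TrueArc fs → (∀ {a} → a ∈ es → a ∉ fs) →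
    All (λ s → All (λ t → ¬ SameClause s t) (map dual fs)) (map dual es)
  duals-disjoint tes tfs disj = AllP.map⁺ (All.tabulate λ a∈ → AllP.map⁺ (All.tabulate λ b∈ same →
    disj a∈ (subst (_∈ _) (sym (dual-injective (All.lookup tes a∈) (All.lookup tfs b∈) same)) b∈)))

-- Weak duality: disjoint path families are bounded by separators, since
-- each path of the family meets the separator in an element of its own.

arc-weak-duality : ∀ {F M l ps AS} → DisjDPathFamily F M l ps → IsArcSeparator F M l AS →
  length ps ≤ length AS
arc-weak-duality {AS = AS} (paths , disjoint) (_ , _ , separates) =
  hitting-bound (arcsOf ∘ toList) AS
    (APairs.map (All.map (¬Any⇒All¬ _)) disjoint)
    (All.map (λ {p} path → ¬All¬⇒Any (_∈A? AS) _ (separates p path)) paths)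
  where
  open Counting (setoid Arc) using (hitting-bound)
  open import Data.List.Membership.DecPropositional _≟E_ using () renaming (_∈?_ to _∈A?_)

clause-weak-duality : ∀ {F M l ps SC} → DisjPathFamily F M l ps → IsSeparator F M l SC →
  length ps ≤ length SC
clause-weak-duality {SC = SC} (paths , disjoint) (_ , _ , separates) =
  hitting-bound toList SC disjoint
    (All.map (λ {w} path → ¬All¬⇒Any (λ s → any? (s ≟C_) SC) _ (separates w path)) paths)
  where open Counting clauseSetoid using (hitting-bound)

optimal : ∀ {A B : Set} (Family : List A → Set) (Separator : List B → Set) →
  (∀ {ps C} → Family ps → Separator C → length ps ≤ length C) →
  ∀ {ps C k} → Family ps → length ps ≡ k → Separator C → length C ≤ k →
  ((Σ (List A) λ ps → Family ps × length ps ≡ k) × (∀ ps → Family ps → length ps ≤ k)) ×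
  ((Σ (List B) λ C → Separator C × length C ≡ k) × (∀ C → Separator C → k ≤ length C))
optimal Family Separator weak {ps} {C} fam refl sep small =
  ((ps , fam , refl) , λ ps′ fam′ → ≤-trans (weak fam′ sep) small) ,
  ((C , sep , ≤-antisym small (weak fam sep)) , λ C′ sep′ → weak fam sep′)

module Reduction (F : TwoCNF) (L : List Lit) (ly : Lit) (swrt : SWRT F (negs L))
                 (ly∉L : ¬ VarOfLits L (var ly)) where

  ly∉negsL : ly ∉ negs L
  ly∉negsL ly∈ with l , l∈L , refl ← ∈-map⁻ neg ly∈ = ly∉L (Any.map (λ { refl → refl }) l∈L)

  open Walks.Menger _≟L_ (implicationArcs F) (negs L) ly ly∉negsL
  open Certificate menger public

  P : List Lit
  P = proj₁ swrt

  sat : IsSatAssignment F P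
  sat = proj₁ (proj₂ swrt)

  open Truth {F} {P} sat

  -- the sources ¬L are true under P (the hypothesis SWRT(F, ¬L))
  source-true : ∀ {x} → x ∈ negs L → VarOfF F (var x) → x ∈ P
  source-true {x} x∈S x∈F
    with l , l∈P , var≡ ← find (proj₁ (proj₂ (proj₂ sat)) (var x) x∈F)
    with same-var l x var≡
  ... | inj₁ refl = l∈P
  ... | inj₂ refl = ⊥-elim (proj₂ (proj₂ swrt) _ l∈P (∈-map⁺ neg x∈S))

  arc-var : ∀ {u v} → IsArc F (u , v) → VarOfF F (var u)
  arc-var = Any.map λ { (inj₁ refl) → inj₁ refl ; (inj₂ refl) → inj₂ refl }

  route-shape : ∀ {p} → IsRoute p → ∃[ x ] ∃[ y ] ∃[ ys ] p ≡ x ∷ y ∷ ys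
  route-shape {x ∷ []}     (x∈S , refl , _) = ⊥-elim (ly∉negsL x∈S)
  route-shape {x ∷ y ∷ ys} _                = x , y , ys , refl

  route-path : ∀ {p} → IsRoute p → IsDPathFromTo F (negs L) ly p
  route-path r@(x∈S , last≡ly , u , ⊆E) with x , y , ys , refl ← route-shape r =
    (s≤s z≤n , u , steps⇒Linked (x ∷ y ∷ ys) (All.map (∈⇒IsArc F) ⊆E)) , x∈S , last≡ly

  route-true : ∀ {p} → IsRoute p → All (_∈ P) (toList p)
  route-true r with x , y , ys , refl ← route-shape r
               with (_ , _ , linked@(arc ∷ _)) , x∈S , _ ← route-path r =
    walk-true (source-true x∈S (arc-var arc)) linked

  route-clausePath : ∀ {p} → IsRoute p → IsPathFromTo F L ly (clausePath p)
  route-clausePath r@(x∈S , last≡ly , u , ⊆E) with x , y , ys , refl ← route-shape r =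
    ((AllP.map⁺ (All.map (∈⇒IsArc F) ⊆E) , clausePath-chained x y ys) ,
     duals-distinct (steps-true (x ∷ y ∷ ys) (route-true r)) (steps-unique (x ∷ y ∷ ys) u)) ,
    neg∈negs x∈S , trans (clausePath-last x y ys) last≡ly

  arc-family : DisjDPathFamily F (negs L) ly routes
  arc-family = All.map route-path routes-valid ,
    APairs.map arc-disjoint (unique-concat⁻ edgesOf routes routes-disjoint)
    where
    arc-disjoint : ∀ {p q} → (∀ {a} → a ∈ edgesOf p → a ∉ edgesOf q) → ArcDisjoint p q
    arc-disjoint {p} {q} disj rewrite arcsOf≡steps (toList p) | arcsOf≡steps (toList q) =
      All.tabulate disj

  clause-family : DisjPathFamily F L ly (map clausePath routes)
  clause-family = AllP.map⁺ (All.map route-clausePath routes-valid) ,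
    APairsP.map⁺ (APairs.map clause-disjoint
      (AllPairs-with routes-valid (unique-concat⁻ edgesOf routes routes-disjoint)))
    where
    clause-disjoint : ∀ {p q} → IsRoute p × IsRoute q × (∀ {a} → a ∈ edgesOf p → a ∉ edgesOf q) →
      ClauseDisjoint (clausePath p) (clausePath q)
    clause-disjoint (rp , rq , disj)
      with x , y , ys , refl ← route-shape rp | x′ , y′ , ys′ , refl ← route-shape rq =
      duals-disjoint (steps-true _ (route-true rp)) (steps-true _ (route-true rq)) disj

  arc-separator : IsArcSeparator F (negs L) ly cut
  arc-separator = All.map (∈⇒IsArc F) cut⊆E , cut-unique , separates
    where
    separates : ∀ p → IsDPathFromTo F (negs L) ly p → ¬ All (_∉ cut) (arcsOf (toList p))
    separates (x ∷ xs) ((_ , _ , linked) , x∈S , last≡ly) avoid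
      rewrite arcsOf≡steps (x ∷ xs) =
      AllP.All¬⇒¬Any avoid
        (cut-separates x xs x∈S (trans (sym (last≡final x xs)) last≡ly)
          (All.map (IsArc⇒∈ F) (Linked⇒steps (x ∷ xs) linked)))

  -- Read as literals, a clause walk from L to ly is a walk of the
  -- implication graph from ¬L to ly, so one of its clauses is the dual of
  -- a cut arc.
  clause-walk-meets-cut : ∀ c cs → IsPathFromTo F L ly (c ∷ cs) → Any (_∈ cut) (map dual (c ∷ cs))
  clause-walk-meets-cut c cs (((c∈F , chained) , _) , c₁∈L , last≡ly) =
    subst (Any (_∈ cut)) (walkLits-steps c cs chained)
      (cut-separates (neg (proj₁ c)) (map proj₂ (c ∷ cs)) (∈-map⁺ neg c₁∈L) ends-at-ly walk⊆E)
    where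
    walk⊆E : All (_∈ implicationArcs F) (steps (toList (walkLits (c ∷ cs))))
    walk⊆E = subst (All (_∈ implicationArcs F)) (sym (walkLits-steps c cs chained))
      (AllP.map⁺ (All.map (λ {s} s∈F → IsArc⇒∈ F (subst (_∈C clauses F) (sym (dual-involutive s)) s∈F)) c∈F))
    ends-at-ly : final (neg (proj₁ c)) (map proj₂ (c ∷ cs)) ≡ ly
    ends-at-ly = trans (final-map proj₂ c cs) (trans (cong proj₂ (sym (last≡final c cs))) last≡ly)

  clause-cut : List Clause
  clause-cut = deduplicate _≟C_ (map dual cut)

  clause-cut-small : length clause-cut ≤ length cut
  clause-cut-small = ≤-trans (length-deduplicate _≟C_ (map dual cut)) (≤-reflexive (length-map dual cut))

  clause-separator : IsSeparator F L ly clause-cut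
  clause-separator = All.tabulate in-F , deduplicate≈-! clauseDecSetoid (map dual cut) , separates
    where
    in-F : ∀ {c} → c ∈ clause-cut → c ∈C clauses F
    in-F c∈ with a , a∈cut , refl ← ∈-map⁻ dual (∈-deduplicate⁻ _≟C_ (map dual cut) c∈) =
      ∈⇒IsArc F (All.lookup cut⊆E a∈cut)
    separates : ∀ w → IsPathFromTo F L ly w → ¬ All (λ s → ¬ (s ∈C clause-cut)) (toList w)
    separates (c ∷ cs) path avoid
      with a , a∈duals , a∈cut ← find (clause-walk-meets-cut c cs path)
      with s , s∈w , refl ← ∈-map⁻ dual a∈duals =
      All.lookup avoid s∈w
        (∈-deduplicate≈⁺ clauseSetoid _≟C_
          (λ z≈y x≈y → Setoid.trans clauseSetoid x≈y (Setoid.sym clauseSetoid z≈y))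
          (Any.map (λ eq → inj₁ (trans (sym (dual-involutive s)) eq)) (∈-map⁺ dual a∈cut)))

theorem2 : (F : TwoCNF) (L : List Lit) (ly : Lit) →
    SWRT F (negs L) →
    ¬ VarOfLits L (var ly) →
    Σ ℕ λ k →
      IsMaxPaths F L ly k × IsMaxArcPaths F (negs L) ly k ×
      IsSepSize F L ly k × IsArcSepSize F (negs L) ly k
theorem2 F L ly swrt ly∉L = length routes ,
  proj₁ clause-optimal , proj₁ arc-optimal , proj₂ clause-optimal , proj₂ arc-optimal
  where
  open Reduction F L ly swrt ly∉L
  arc-optimal : IsMaxArcPaths F (negs L) ly (length routes) × IsArcSepSize F (negs L) ly (length routes)
  arc-optimal = optimal (DisjDPathFamily F (negs L) ly) (IsArcSeparator F (negs L) ly)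
    (arc-weak-duality {F} {negs L} {ly})
    arc-family refl arc-separator cut-small
  clause-optimal : IsMaxPaths F L ly (length routes) × IsSepSize F L ly (length routes)
  clause-optimal = optimal (DisjPathFamily F L ly) (IsSeparator F L ly)
    (clause-weak-duality {F} {L} {ly})
    clause-family (length-map clausePath routes) clause-separator (≤-trans clause-cut-small cut-small)
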